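{- Let $M=\langle W,Q,\{R_w\}_{w\in W},v\rangle$ be a model whose frame belongs to $\mathbf{F}^{dL}$, let $\Gamma$ be a set of formulas closed under subformulas, let $M^f_\Gamma=\langle W^f,Q^f,\{R^f_{[w]_\Gamma}\},v^f\rangle$ be the filtration of $M$ through $\Gamma$, and let $M^+_\Gamma=\langle W^f,Q^f,\{R^+_{[w]_\Gamma}\},v^f\rangle$ where $R^+_{[w]_\Gamma}=R^f_{[w]_\Gamma}\cup\{\langle A,B\rangle:\langle d(A),d(B)\rangle\in R^f_{[w]_\Gamma}\}$. Then for every $A\in\Gamma$ and $w\in W$: $M^f_\Gamma,[w]_\Gamma\vDash A$ iff $M^+_\Gamma,[w]_\Gamma\vDash A$.
   Context: Language: variables $p_0,p_1,\dots$ ($\mathrm{Var}$), unary $\neg,\Box,\Diamond$, binary $\wedge,\vee,\rightarrow$; $\mathrm{For}$ its formulas. Demodalization $d$: $d(p)=p$, $d(\neg A)=\neg d(A)$, $d(A\star B)=d(A)\star d(B)$ for $\star\in\{\wedge,\vee,\rightarrow\}$, $d(\Box A)=d(\Diamond A)=d(A)$. A model $\langle W,Q,\{R_w\},v\rangle$: $W\neq\emptyset$, $Q\subseteq W\times W$, $R_w\subseteq\mathrm{For}\times\mathrm{For}$, $v:W\times\mathrm{Var}\to\{0,1\}$. Truth at $w$: $p$ iff $v(w,p)=1$; $\neg,\wedge,\vee$ classical; $\Box B$ iff $B$ true at all $Q$-successors; $\Diamond B$ iff true at some $Q$-successor; $B\rightarrow C$ iff ($B$ false or $C$ true at $w$)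 and $R_w(B,C)$. $\mathbf{F}^{dL}$: frames where every $R_w$ satisfies, for all $A,B$: not $R(A,\neg A)$; not $R(\neg A,A)$; $R(A,B)\Rightarrow$ not $R(A,\neg B)$; $R(A\rightarrow B,\neg(A\rightarrow\neg B))$; $R(A\rightarrow\neg B,\neg(A\rightarrow B))$; $R(d(A),d(B))\Rightarrow R(A,B)$. $\Gamma$ closed under subformulas: $A\star B\in\Gamma\Rightarrow A,B\in\Gamma$ for binary $\star$, $\ast A\in\Gamma\Rightarrow A\in\Gamma$ for $\ast\in\{\neg,\Box,\Diamond\}$. $w_1\sim_\Gamma w_2$ iff for all $A,B\in\Gamma$: ($M,w_1\vDash A$ iff $M,w_2\vDash A$) and ($R_{w_1}(A,B)$ iff $R_{w_2}(A,B)$); $[w]_\Gamma$ its class. Filtration: $W^f=\{[w]_\Gamma\}$; $[w_1]_\Gamma Q^f[w_2]_\Gamma$ iff $Q(w_1',w_2')$ for some $w_1'\sim_\Gamma w_1$, $w_2'\sim_\Gamma w_2$; $R^f_{[w]_\Gamma}=\{\langle A,B\rangle\in R_w:A,B\in\Gamma\}$; $v^f([w]_\Gamma,p)=v(w,p)$. -}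

module Defs where

open import Data.Nat using (ℕ)
open import Data.Bool using (Bool; true)
open import Data.Product using (Σ; ∃; _×_; _,_)
open import Data.Sum using (_⊎_)
open import Data.Empty using (⊥)
open import Relation.Nullary using (¬_)
open import Relation.Binary.PropositionalEquality using (_≡_)
open import Function.Bundles using (_⇔_)

data For : Set where
  var  : ℕ → For
  neg  : For → For
  box  : For → For
  dia  : For → For
  _∧'_ : For → For → For
  _∨'_ : For → For → For
  _⇒_  : For → For → For

d : For → For
d (var p)   = var p
d (neg A)   = neg (d A)
d (box A)   = d A
d (dia A)   = d A
d (A ∧' B)  = d A ∧' d B
d (A ∨' B)  = d A ∨' d B
d (A ⇒ B)   = d A ⇒ d B

record Model : Set₁ where
  field
    W          : Set
    inhabitant : W
    Q          : W → W → Set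
    R          : W → For → For → Set
    v          : W → ℕ → Bool

_,_⊨_ : (M : Model) → Model.W M → For → Set
M , w ⊨ var p   = Model.v M w p ≡ true
M , w ⊨ neg A   = ¬ (M , w ⊨ A)
M , w ⊨ box A   = ∀ u → Model.Q M w u → M , u ⊨ A
M , w ⊨ dia A   = ∃ λ u → Model.Q M w u × (M , u ⊨ A)
M , w ⊨ (A ∧' B) = (M , w ⊨ A) × (M , w ⊨ B)
M , w ⊨ (A ∨' B) = (M , w ⊨ A) ⊎ (M , w ⊨ B)
M , w ⊨ (A ⇒ B)  = ((¬ (M , w ⊨ A)) ⊎ (M , w ⊨ B)) × Model.R M w A B

IsDLRel : (For → For → Set) → Set
IsDLRel R =
    (∀ A → ¬ R A (neg A))
  × (∀ A → ¬ R (neg A) A)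
  × (∀ A B → R A B → ¬ R A (neg B))
  × (∀ A B → R (A ⇒ B) (neg (A ⇒ neg B)))
  × (∀ A B → R (A ⇒ neg B) (neg (A ⇒ B)))
  × (∀ A B → R (d A) (d B) → R A B)

FrameInFdL : Model → Set
FrameInFdL M = ∀ w → IsDLRel (Model.R M w)

SubformulaClosed : (For → Set) → Set
SubformulaClosed Γ =
    (∀ A B → Γ (A ∧' B) → Γ A × Γ B)
  × (∀ A B → Γ (A ∨' B) → Γ A × Γ B)
  × (∀ A B → Γ (A ⇒ B) → Γ A × Γ B)
  × (∀ A → Γ (neg A) → Γ A)
  × (∀ A → Γ (box A) → Γ A)
  × (∀ A → Γ (dia A) → Γ A)

Equiv : (M : Model) (Γ : For → Set) → Model.W M → Model.W M → Set
Equiv M Γ w₁ w₂ =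
    (∀ A → Γ A → (M , w₁ ⊨ A) ⇔ (M , w₂ ⊨ A))
  × (∀ A B → Γ A → Γ B → Model.R M w₁ A B ⇔ Model.R M w₂ A B)

-- Agda has no quotient types, so the class
-- [w]_Γ is represented by any of its members w (setoid presentation):
-- the carrier is W, and Q^f, R^f, v^f are defined on representatives
-- exactly as in the paper.
Qf : (M : Model) (Γ : For → Set) → Model.W M → Model.W M → Set
Qf M Γ w₁ w₂ = ∃ λ w₁' → ∃ λ w₂' →
  Equiv M Γ w₁' w₁ × Equiv M Γ w₂' w₂ × Model.Q M w₁' w₂'

Rf : (M : Model) (Γ : For → Set) → Model.W M → For → For → Set
Rf M Γ w A B = Model.R M w A B × Γ A × Γ B

Filtration : (M : Model) (Γ : For → Set) → Model
Filtration M Γ = record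
  { W = Model.W M
  ; inhabitant = Model.inhabitant M
  ; Q = Qf M Γ
  ; R = Rf M Γ
  ; v = Model.v M
  }

Rplus : (M : Model) (Γ : For → Set) → Model.W M → For → For → Set
Rplus M Γ w A B = Rf M Γ w A B ⊎ Rf M Γ w (d A) (d B)

FiltrationPlus : (M : Model) (Γ : For → Set) → Model
FiltrationPlus M Γ = record
  { W = Model.W M
  ; inhabitant = Model.inhabitant M
  ; Q = Qf M Γ
  ; R = Rplus M Γ
  ; v = Model.v M
  }

-- M^f and M^+ differ only in the relations R_w, so truth of a formula of Γ depends only on
-- R_w restricted to Γ × Γ. There the two relations coincide: an extra pair ⟨A, B⟩ of R^+
-- has ⟨d A, d B⟩ ∈ R_w, hence ⟨A, B⟩ ∈ R_w by the last condition of F^dL.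
module Submission where

open import Defs
open import Data.Product using (_×_; _,_; proj₂)
open import Data.Sum using (_⊎_; inj₁; inj₂)
open import Data.Product.Function.NonDependent.Propositional using (_×-⇔_)
open import Data.Sum.Function.Propositional using (_⊎-⇔_)
open import Function.Bundles using (_⇔_; mk⇔; Equivalence)
open import Function.Construct.Identity using (⇔-id)
open import Function.Related.TypeIsomorphisms using (¬-cong-⇔)

open Equivalence using (to; from)

Relation : Model → Set₁
Relation M = Model.W M → For → For → Set

withRelation : (M : Model) → Relation M → Model
withRelation M R′ = record
  { W = Model.W M
  ; inhabitant = Model.inhabitant M
  ; Q = Model.Q M
  ; R = R′
  ; v = Model.v M
  }

AgreeOn : (Γ : For → Set) (M : Model) → Relation M → Set
AgreeOn Γ M R′ = ∀ w A B → Γ A → Γ B → Model.R M w A B ⇔ R′ w A B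

⊨-cong-relation : (M : Model) (R′ : Relation M) (Γ : For → Set) →
  SubformulaClosed Γ → AgreeOn Γ M R′ →
  ∀ A → Γ A → (w : Model.W M) → (M , w ⊨ A) ⇔ (withRelation M R′ , w ⊨ A)
⊨-cong-relation M R′ Γ (Γ-∧ , Γ-∨ , Γ-⇒ , Γ-neg , Γ-box , Γ-dia) agree = go
  where
  go : ∀ A → Γ A → (w : Model.W M) → (M , w ⊨ A) ⇔ (withRelation M R′ , w ⊨ A)
  go (var p) _ w = ⇔-id _
  go (neg A) γ w = ¬-cong-⇔ (go A (Γ-neg A γ) w)
  go (box A) γ w = mk⇔ (λ □A u wQu → to   (go A (Γ-box A γ) u) (□A u wQu))
                       (λ □A u wQu → from (go A (Γ-box A γ) u) (□A u wQu))
  go (dia A) γ w = mk⇔ (λ { (u , wQu , uA) → u , wQu , to   (go A (Γ-dia A γ) u) uA })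
                       (λ { (u , wQu , uA) → u , wQu , from (go A (Γ-dia A γ) u) uA })
  go (A ∧' B) γ w with Γ-∧ A B γ
  ... | γA , γB = go A γA w ×-⇔ go B γB w
  go (A ∨' B) γ w with Γ-∨ A B γ
  ... | γA , γB = go A γA w ⊎-⇔ go B γB w
  go (A ⇒ B) γ w with Γ-⇒ A B γ
  ... | γA , γB = (¬-cong-⇔ (go A γA w) ⊎-⇔ go B γB w) ×-⇔ agree w A B γA γB

FrameInFdL⇒d-reflecting : (M : Model) → FrameInFdL M →
  ∀ w A B → Model.R M w (d A) (d B) → Model.R M w A B
FrameInFdL⇒d-reflecting M fdL w = proj₂ (proj₂ (proj₂ (proj₂ (proj₂ (fdL w)))))

Rf⇔Rplus : (M : Model) → FrameInFdL M → (Γ : For → Set) →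
  AgreeOn Γ (Filtration M Γ) (Rplus M Γ)
Rf⇔Rplus M fdL Γ w A B γA γB = mk⇔ inj₁ fromRplus
  where
  fromRplus : Rplus M Γ w A B → Rf M Γ w A B
  fromRplus (inj₁ wRfAB)            = wRfAB
  fromRplus (inj₂ (wRdAdB , _ , _)) = FrameInFdL⇒d-reflecting M fdL w A B wRdAdB , γA , γB

mainTheorem13 : (M : Model) → FrameInFdL M →
    (Γ : For → Set) → SubformulaClosed Γ →
    ∀ A → Γ A → (w : Model.W M) →
    (Filtration M Γ , w ⊨ A) ⇔ (FiltrationPlus M Γ , w ⊨ A)
mainTheorem13 M fdL Γ closed =
  ⊨-cong-relation (Filtration M Γ) (Rplus M Γ) Γ closed (Rf⇔Rplus M fdL Γ)
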